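{- Let $q$ be a prime power and $k$ a non-negative integer. Let $M$ be a simple $GF(q)$-matroid with no coloops that is $k$-paving. Then $M$ is a circuit (i.e., $E(M)$ is itself a circuit of $M$), or $r(M) \leq (q+1)(k-1)+2q$.
   Context: A $GF(q)$-matroid is a matroid representable over the field with $q$ elements. For a matroid $M$ of rank $r$ and a non-negative integer $k$, an element $t$ of $M$ is called $k$-loose if every circuit of $M$ that contains $t$ has size greater than $r-k$; $M$ is $k$-paving if every element of $M$ is $k$-loose. A matroid is simple if it has no loops and no parallel pairs. -}

module Defs where

open import Level using (Level; _⊔_)
open import Algebra.Bundles using (CommutativeRing)
open import Data.Nat using (ℕ; zero; suc; _^_; _≤_; _<_)
import Data.Nat as N
open import Data.Nat.Primality using (Prime)
open import Data.Fin using (Fin)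
open import Data.Fin.Subset using (Subset; _∈_; _∉_; _⊂_; ⁅_⁆; _∪_; ∣_∣; ⊤)
open import Data.Product using (Σ; ∃; _×_; _,_)
open import Relation.Nullary using (¬_)
open import Relation.Binary.PropositionalEquality using (_≡_)

IsPrimePower : ℕ → Set
IsPrimePower q = ∃ λ p → ∃ λ e → Prime p × q ≡ p ^ suc e

module _ {c ℓ : Level} (R : CommutativeRing c ℓ) where
  open CommutativeRing R

  record IsField : Set (c ⊔ ℓ) where
    field
      1≉0 : ¬ (1# ≈ 0#)
      inverse : ∀ x → ¬ (x ≈ 0#) → Σ Carrier λ y → x * y ≈ 1#

  record HasSize (q : ℕ) : Set (c ⊔ ℓ) where
    field
      enum : Fin q → Carrier
      enum-injective : ∀ i j → enum i ≈ enum j → i ≡ j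
      enum-surjective : ∀ x → Σ (Fin q) λ i → enum i ≈ x

  IsGF : ℕ → Set (c ⊔ ℓ)
  IsGF q = IsField × HasSize q

  sumF : (n : ℕ) → (Fin n → Carrier) → Carrier
  sumF zero f = 0#
  sumF (suc n) f = f Fin.zero + sumF n (λ i → f (Fin.suc i))

  -- The vector matroid on ground set Fin n whose element e is the column
  -- vector A e ∈ Carrier^d.
  module VectorMatroid {n d : ℕ} (A : Fin n → Fin d → Carrier) where

    Dependent : Subset n → Set (c ⊔ ℓ)
    Dependent S = Σ (Fin n → Carrier) λ co →
        (∀ i → i ∉ S → co i ≈ 0#)
      × (∃ λ i → ¬ (co i ≈ 0#))
      × (∀ j → sumF n (λ i → co i * A i j) ≈ 0#)

    Independent : Subset n → Set (c ⊔ ℓ)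
    Independent S = ¬ Dependent S

    Circuit : Subset n → Set (c ⊔ ℓ)
    Circuit C = Dependent C × (∀ D → D ⊂ C → Independent D)

    IsRank : ℕ → Set (c ⊔ ℓ)
    IsRank r = (∃ λ S → Independent S × ∣ S ∣ ≡ r)
             × (∀ S → Independent S → ∣ S ∣ ≤ r)

    Loop : Fin n → Set (c ⊔ ℓ)
    Loop e = Circuit ⁅ e ⁆

    ParallelPair : Fin n → Fin n → Set (c ⊔ ℓ)
    ParallelPair e f = ¬ (e ≡ f) × Circuit (⁅ e ⁆ ∪ ⁅ f ⁆)

    Simple : Set (c ⊔ ℓ)
    Simple = (∀ e → ¬ Loop e) × (∀ e f → ¬ ParallelPair e f)

    Coloop : Fin n → Set (c ⊔ ℓ)
    Coloop e = ∀ C → Circuit C → e ∉ C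

    NoColoops : Set (c ⊔ ℓ)
    NoColoops = ∀ e → ¬ Coloop e

    -- for a matroid of rank r: t is k-loose iff every circuit containing t
    -- has size > r - k  (stated as r < |C| + k, avoiding truncated subtraction)
    KLoose : ℕ → ℕ → Fin n → Set (c ⊔ ℓ)
    KLoose r k t = ∀ C → Circuit C → t ∈ C → r < ∣ C ∣ N.+ k

    KPaving : ℕ → ℕ → Set (c ⊔ ℓ)
    KPaving r k = ∀ t → KLoose r k t

    IsCircuitMatroid : Set (c ⊔ ℓ)
    IsCircuitMatroid = Circuit ⊤

{-# OPTIONS --safe #-}
module Submission where

-- Fix a basis B, so r = |B|, and count the elements outside it.  If there are none, every element
-- is a coloop, so the ground set is empty and r = 0.  If there is exactly one, e, any two nonzero
-- linear relations among the columns are proportional; as every element lies in a circuit, no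
-- nonzero relation vanishes anywhere, so no proper subset is dependent.  If there are two, e and f,
-- with fundamental relations u and v (v vanishes at e), the q + 1 relations v and u - λv (λ ∈
-- GF(q)) are nonzero and supported in B ∪ {e, f}.  Each coordinate vanishes on at least one of
-- them, so their supports have total size at most q (r + 2); each support contains a circuit, of
-- size > r - k by k-pavingness, so (q + 1)(r + 1 - k) ≤ q (r + 2).  Over a finite field linear
-- dependence is decidable by exhaustive search, which is what turns the negative hypotheses into
-- the witnesses this argument needs.

open import Defs
open import Level using (Level)
open import Algebra.Bundles using (CommutativeRing)
open import Data.Nat using (ℕ; suc; _≤_; _<_; z≤n; s≤s)
import Data.Nat as ℕ
import Data.Nat.Properties as ℕₚ
open import Data.Nat.Induction using (<-wellFounded)
open import Data.Bool using (Bool; true; false; not)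
open import Data.Fin using (Fin; zero; suc; finToFun; funToFin) renaming (_≟_ to _≟ᶠ_)
open import Data.Fin.Properties using (any?; all?; finToFun-funToFin; nonZeroIndex)
open import Data.Fin.Subset using (Subset; _∈_; _∉_; _⊆_; _⊂_; _∪_; _─_; ⁅_⁆; ∣_∣; ⊤; Nonempty)
open import Data.Fin.Subset.Properties
  using (_∈?_; p⊆p∪q; x∈p∪q⁺; x∈p∪q⁻; x∈⁅x⁆; x∈⁅y⁆⇒x≡y; ∣⁅x⁆∣≡1; ∣⊥∣≡0; ∣p∣≤∣x∷p∣; ⊆-max;
         x∈p⇒p-x⊂p; x∈p∧x≢y⇒x∈p-y; p⊂q⇒∣p∣<∣q∣; p⊆q⇒∣p∣≤∣q∣; Empty-unique)
open import Data.Vec using ([]; _∷_; lookup; tabulate)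
open import Data.Vec.Properties using (lookup∘tabulate; lookup⇒[]=; []=⇒lookup)
open import Data.Vec.Functional using (Vector)
open import Data.Product using (∃; ∃₂; _×_; _,_; proj₁; proj₂)
open import Data.Sum using (_⊎_; inj₁; inj₂; [_,_]′) renaming (map₁ to ⊎-map₁)
open import Function using (_∘_; id; case_of_)
open import Induction.WellFounded using (Acc; acc)
open import Relation.Nullary using (¬_; Dec; yes; no; does; contradiction)
open import Relation.Nullary.Decidable
  using (map′; _×-dec_; _→-dec_; ¬?; decidable-stable; dec-true; dec-false)
open import Relation.Unary using (Pred)
open import Relation.Binary.PropositionalEquality as ≡ using (_≡_; _≢_; refl)
open import Algebra.Properties.Semiring.Sum ℕₚ.+-*-semiring
  using (sum; sum-syntax; sum-cong-≗; ∑-comm; ∑-distrib-+; *-distribˡ-sum)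
import Algebra.Properties.Semiring.Sum as SemiringSum
import Algebra.Properties.Ring as RingProperties
import Relation.Binary.Reasoning.Setoid as SetoidReasoning

module _ where
  open import Data.Nat using (_+_; _*_)
  open ℕₚ using (≤-refl; ≤-reflexive; ≤-trans; +-mono-≤; +-monoˡ-≤; +-monoʳ-≤; +-comm; +-identityʳ;
                *-identityʳ; +-suc; +-cancelˡ-≤; m≤n+m; module ≤-Reasoning)
  open import Data.Nat.Tactic.RingSolver using (solve-∀)

  indicator : Bool → ℕ
  indicator false = 0
  indicator true  = 1

  indicator≤1 : ∀ b → indicator b ≤ 1
  indicator≤1 false = z≤n
  indicator≤1 true  = ≤-refl

  sum-mono-≤ : ∀ {m} {f g : Vector ℕ m} → (∀ i → f i ≤ g i) → sum f ≤ sum g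
  sum-mono-≤ {0}     f≤g = z≤n
  sum-mono-≤ {suc m} f≤g = +-mono-≤ (f≤g zero) (sum-mono-≤ (f≤g ∘ suc))

  sum-const : ∀ m x → ∑[ i < m ] x ≡ m * x
  sum-const 0       x = refl
  sum-const (suc m) x = ≡.cong (x +_) (sum-const m x)

  sum-zero : ∀ {m} {f : Vector ℕ m} → (∀ i → f i ≡ 0) → sum f ≡ 0
  sum-zero {0}     f≡0 = refl
  sum-zero {suc m} f≡0 = ≡.cong₂ _+_ (f≡0 zero) (sum-zero (f≡0 ∘ suc))

  sum-indicators≤ : ∀ {m} {f : Vector ℕ m} → (∀ i → f i ≤ 1) → sum f ≤ m
  sum-indicators≤ {m} {f} f≤1 = begin
    sum f            ≤⟨ sum-mono-≤ f≤1 ⟩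
    ∑[ i < m ] 1     ≡⟨ sum-const m 1 ⟩
    m * 1            ≡⟨ *-identityʳ m ⟩
    m                ∎
    where open ≤-Reasoning

  sum-indicators-with-zero≤ : ∀ {m} {f : Vector ℕ (suc m)} → (∀ i → f i ≤ 1) →
                              ∀ j → f j ≡ 0 → sum f ≤ m
  sum-indicators-with-zero≤ {m} {f} f≤1 zero f₀≡0 = begin
    f zero + sum (f ∘ suc)  ≡⟨ ≡.cong (_+ sum (f ∘ suc)) f₀≡0 ⟩
    sum (f ∘ suc)           ≤⟨ sum-indicators≤ (f≤1 ∘ suc) ⟩
    m                       ∎
    where open ≤-Reasoning
  sum-indicators-with-zero≤ {suc m} f≤1 (suc j) fj≡0 =
    +-mono-≤ (f≤1 zero) (sum-indicators-with-zero≤ (f≤1 ∘ suc) j fj≡0)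

  ∣p∣≡∑indicator : ∀ {n} (p : Subset n) → ∣ p ∣ ≡ ∑[ i < n ] indicator (lookup p i)
  ∣p∣≡∑indicator []          = refl
  ∣p∣≡∑indicator (false ∷ p) = ∣p∣≡∑indicator p
  ∣p∣≡∑indicator (true ∷ p)  = ≡.cong suc (∣p∣≡∑indicator p)

  ∣p∪q∣≤∣p∣+∣q∣ : ∀ {n} (p q : Subset n) → ∣ p ∪ q ∣ ≤ ∣ p ∣ + ∣ q ∣
  ∣p∪q∣≤∣p∣+∣q∣ []          []          = z≤n
  ∣p∪q∣≤∣p∣+∣q∣ (true ∷ p)  (y ∷ q)     =
    s≤s (≤-trans (∣p∪q∣≤∣p∣+∣q∣ p q) (+-monoʳ-≤ ∣ p ∣ (∣p∣≤∣x∷p∣ y q)))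
  ∣p∪q∣≤∣p∣+∣q∣ (false ∷ p) (true ∷ q)  =
    ≤-trans (s≤s (∣p∪q∣≤∣p∣+∣q∣ p q)) (≤-reflexive (≡.sym (+-suc ∣ p ∣ ∣ q ∣)))
  ∣p∪q∣≤∣p∣+∣q∣ (false ∷ p) (false ∷ q) = ∣p∪q∣≤∣p∣+∣q∣ p q

  ∣p∪⁅x⁆∣≤1+∣p∣ : ∀ {n} (p : Subset n) x → ∣ p ∪ ⁅ x ⁆ ∣ ≤ suc ∣ p ∣
  ∣p∪⁅x⁆∣≤1+∣p∣ p x = begin
    ∣ p ∪ ⁅ x ⁆ ∣    ≤⟨ ∣p∪q∣≤∣p∣+∣q∣ p ⁅ x ⁆ ⟩
    ∣ p ∣ + ∣ ⁅ x ⁆ ∣ ≡⟨ ≡.cong (∣ p ∣ +_) (∣⁅x⁆∣≡1 x) ⟩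
    ∣ p ∣ + 1        ≡⟨ +-comm ∣ p ∣ 1 ⟩
    suc ∣ p ∣        ∎
    where open ≤-Reasoning

  -- r ≤ (q + 1)(k - 1) + 2q, with q + 1 added to both sides to avoid truncated subtraction.
  RankBound : ℕ → ℕ → ℕ → Set
  RankBound q k r = r + (q + 1) ≤ (q + 1) * k + 2 * q

  RankBound-0 : ∀ {q} k → 1 ≤ q → RankBound q k 0
  RankBound-0 {q} k 1≤q = begin
    q + 1               ≤⟨ +-monoʳ-≤ q 1≤q ⟩
    q + q               ≡⟨ ≡.cong (q +_) (+-identityʳ q) ⟨
    2 * q               ≤⟨ m≤n+m (2 * q) ((q + 1) * k) ⟩
    (q + 1) * k + 2 * q ∎
    where open ≤-Reasoning

  pencil-count⇒RankBound : ∀ q k r (s : Vector ℕ (suc q)) →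
    (∀ j → r < s j + k) → sum s ≤ q * suc (suc r) → RankBound q k r
  pencil-count⇒RankBound q k r s r<s+k ∑s≤ = +-cancelˡ-≤ (q * r) _ _ (begin
    q * r + (r + (q + 1))          ≡⟨ expand-lhs q r ⟩
    suc q * suc r                  ≡⟨ sum-const (suc q) (suc r) ⟨
    ∑[ j < suc q ] suc r           ≤⟨ sum-mono-≤ r<s+k ⟩
    ∑[ j < suc q ] (s j + k)       ≡⟨ ∑-distrib-+ s (λ _ → k) ⟩
    sum s + ∑[ j < suc q ] k       ≡⟨ ≡.cong (sum s +_) (sum-const (suc q) k) ⟩
    sum s + suc q * k              ≤⟨ +-monoˡ-≤ (suc q * k) ∑s≤ ⟩
    q * suc (suc r) + suc q * k    ≡⟨ expand-rhs q k r ⟩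
    q * r + ((q + 1) * k + 2 * q)  ∎)
    where
    open ≤-Reasoning
    expand-lhs : ∀ q r → q * r + (r + (q + 1)) ≡ suc q * suc r
    expand-lhs = solve-∀
    expand-rhs : ∀ q k r → q * suc (suc r) + suc q * k ≡ q * r + ((q + 1) * k + 2 * q)
    expand-rhs = solve-∀

p⊆q∧x∉p⇒p⊆q-x : ∀ {n} {p q : Subset n} {x} → p ⊆ q → x ∉ p → p ⊆ q ─ ⁅ x ⁆
p⊆q∧x∉p⇒p⊆q-x p⊆q x∉p y∈p = x∈p∧x≢y⇒x∈p-y (p⊆q y∈p) λ { refl → x∉p y∈p }

misses-none-one-or-two : ∀ {n} (p : Subset n) →
  (∀ i → i ∈ p) ⊎ (∃ λ e → e ∉ p × ∀ i → i ∉ p → i ≡ e) ⊎ (∃₂ λ e f → e ∉ p × f ∉ p × e ≢ f)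
misses-none-one-or-two p with any? (λ e → ¬? (e ∈? p))
... | no  none = inj₁ λ i → decidable-stable (i ∈? p) (λ i∉p → none (i , i∉p))
... | yes (e , e∉p) with any? (λ f → ¬? (f ∈? p) ×-dec ¬? (e ≟ᶠ f))
...   | yes (f , f∉p , e≢f) = inj₂ (inj₂ (e , f , e∉p , f∉p , e≢f))
...   | no  none = inj₂ (inj₁ (e , e∉p , λ i i∉p →
          ≡.sym (decidable-stable (e ≟ᶠ i) (λ e≢i → none (i , i∉p , e≢i)))))

module FiniteCarrier {c ℓ} (R : CommutativeRing c ℓ) {q} (size : HasSize R q) where
  open CommutativeRing R hiding (refl; zero)
  open HasSize size

  index : Carrier → Fin q
  index x = proj₁ (enum-surjective x)

  enum-index : ∀ x → enum (index x) ≈ x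
  enum-index x = proj₂ (enum-surjective x)

  size-positive : 0 < q
  size-positive = ℕ.>-nonZero⁻¹ q {{nonZeroIndex (index 0#)}}

  _≈?_ : ∀ x y → Dec (x ≈ y)
  x ≈? y = map′
    (λ ix≡iy → trans (sym (enum-index x)) (trans (reflexive (≡.cong enum ix≡iy)) (enum-index y)))
    (λ x≈y → enum-injective _ _ (trans (enum-index x) (trans x≈y (sym (enum-index y)))))
    (index x ≟ᶠ index y)

  anyVector? : ∀ {m p} {P : Pred (Fin m → Carrier) p} →
               (∀ {u v} → (∀ i → u i ≈ v i) → P u → P v) → (∀ u → Dec (P u)) → Dec (∃ P)
  anyVector? resp P? = map′
    (λ (k , Pk) → enum ∘ finToFun k , Pk)
    (λ (u , Pu) → funToFin (index ∘ u) , resp (round-trip u) Pu)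
    (any? (P? ∘ (enum ∘_) ∘ finToFun))
    where
    round-trip : ∀ u i → u i ≈ enum (finToFun (funToFin (index ∘ u)) i)
    round-trip u i = sym (trans (reflexive (≡.cong enum (finToFun-funToFin (index ∘ u) i)))
                                (enum-index (u i)))

module VectorMatroidProperties {c ℓ} (R : CommutativeRing c ℓ)
                               {n d} (A : Fin n → Fin d → CommutativeRing.Carrier R) where
  open CommutativeRing R hiding (refl; zero)
  open RingProperties ring using (-0#≈0#; -‿distribˡ-*)
  open SemiringSum semiring using ()
    renaming ( sum to ∑ᴿ; sum-cong-≋ to ∑ᴿ-cong; ∑-distrib-+ to ∑ᴿ-distrib-+
             ; *-distribˡ-sum to *-distribˡ-∑ᴿ)
  open SetoidReasoning setoid
  open VectorMatroid R A

  SupportedIn : Subset n → (Fin n → Carrier) → Set ℓ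
  SupportedIn S w = ∀ i → i ∉ S → w i ≈ 0#

  Nonzero : (Fin n → Carrier) → Set ℓ
  Nonzero w = ∃ λ i → ¬ (w i ≈ 0#)

  InKernel : (Fin n → Carrier) → Set ℓ
  InKernel w = ∀ j → sumF R n (λ i → w i * A i j) ≈ 0#

  SupportedIn-mono : ∀ {S T w} → S ⊆ T → SupportedIn S w → SupportedIn T w
  SupportedIn-mono S⊆T w-supp i i∉T = w-supp i (i∉T ∘ S⊆T)

  SupportedIn-∪⁅x⁆ : ∀ {S x w} → SupportedIn (S ∪ ⁅ x ⁆) w → w x ≈ 0# → SupportedIn S w
  SupportedIn-∪⁅x⁆ {S} {x} w-supp wx≈0 i i∉S with i ≟ᶠ x
  ... | yes refl = wx≈0
  ... | no  i≢x  = w-supp i ([ i∉S , i≢x ∘ x∈⁅y⁆⇒x≡y x ]′ ∘ x∈p∪q⁻ S ⁅ x ⁆)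

  Dependent-mono : ∀ {S T} → S ⊆ T → Dependent S → Dependent T
  Dependent-mono S⊆T (w , w-supp , w-nz , w-ker) = w , SupportedIn-mono S⊆T w-supp , w-nz , w-ker

  Circuit-nonempty : ∀ {C} → Circuit C → Nonempty C
  Circuit-nonempty {C} ((w , w-supp , (i , wi≉0) , _) , _) =
    i , decidable-stable (i ∈? C) (wi≉0 ∘ w-supp i)

  circuit-relation-nonzero : ∀ {C w x} → Circuit C → SupportedIn C w → InKernel w → Nonzero w →
                             x ∈ C → ¬ (w x ≈ 0#)
  circuit-relation-nonzero {C} {w} {x} (_ , minimal) w-supp w-ker w-nz x∈C wx≈0 =
    minimal (C ─ ⁅ x ⁆) (x∈p⇒p-x⊂p x∈C)
      (w , SupportedIn-∪⁅x⁆ (SupportedIn-mono C⊆C-x∪x w-supp) wx≈0 , w-nz , w-ker)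
    where
    C⊆C-x∪x : C ⊆ (C ─ ⁅ x ⁆) ∪ ⁅ x ⁆
    C⊆C-x∪x {i} i∈C with i ≟ᶠ x
    ... | yes refl = x∈p∪q⁺ (inj₂ (x∈⁅x⁆ x))
    ... | no  i≢x  = x∈p∪q⁺ (inj₁ (x∈p∧x≢y⇒x∈p-y i∈C i≢x))

  sumF≡∑ᴿ : ∀ m (f : Fin m → Carrier) → sumF R m f ≡ ∑ᴿ f
  sumF≡∑ᴿ 0       f = refl
  sumF≡∑ᴿ (suc m) f = ≡.cong (f zero +_) (sumF≡∑ᴿ m (f ∘ suc))

  InKernel-cong : ∀ {u v} → (∀ i → u i ≈ v i) → InKernel u → InKernel v
  InKernel-cong {u} {v} u≈v u-ker j = begin
    sumF R n (λ i → v i * A i j)  ≡⟨ sumF≡∑ᴿ n _ ⟩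
    ∑ᴿ (λ i → v i * A i j)        ≈⟨ ∑ᴿ-cong (λ i → *-congʳ (sym (u≈v i))) ⟩
    ∑ᴿ (λ i → u i * A i j)        ≡⟨ sumF≡∑ᴿ n _ ⟨
    sumF R n (λ i → u i * A i j)  ≈⟨ u-ker j ⟩
    0#                            ∎

  InKernel-u-a*v : ∀ {u v} → InKernel u → InKernel v → ∀ a → InKernel (λ i → u i - a * v i)
  InKernel-u-a*v {u} {v} u-ker v-ker a j = begin
    sumF R n (λ i → (u i - a * v i) * A i j)        ≡⟨ sumF≡∑ᴿ n _ ⟩
    ∑ᴿ (λ i → (u i - a * v i) * A i j)              ≈⟨ ∑ᴿ-cong termwise ⟩
    ∑ᴿ (λ i → u i * A i j + - a * (v i * A i j))    ≈⟨ ∑ᴿ-distrib-+ (λ i → u i * A i j) _ ⟩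
    ∑ᴿ (λ i → u i * A i j) + ∑ᴿ (λ i → - a * (v i * A i j))
      ≈⟨ +-congˡ (*-distribˡ-∑ᴿ (- a) (λ i → v i * A i j)) ⟨
    ∑ᴿ (λ i → u i * A i j) + - a * ∑ᴿ (λ i → v i * A i j)
      ≈⟨ +-cong (kernel u-ker) (*-congˡ (kernel v-ker)) ⟩
    0# + - a * 0#                                   ≈⟨ +-identityˡ _ ⟩
    - a * 0#                                        ≈⟨ zeroʳ (- a) ⟩
    0#                                              ∎
    where
    kernel : ∀ {w} → InKernel w → ∑ᴿ (λ i → w i * A i j) ≈ 0#
    kernel {w} w-ker = trans (reflexive (≡.sym (sumF≡∑ᴿ n _))) (w-ker j)
    termwise : ∀ i → (u i - a * v i) * A i j ≈ u i * A i j + - a * (v i * A i j)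
    termwise i = trans (distribʳ (A i j) (u i) (- (a * v i)))
      (+-congˡ (trans (sym (-‿distribˡ-* (a * v i) (A i j)))
               (trans (-‿cong (*-assoc a (v i) (A i j))) (-‿distribˡ-* a (v i * A i j)))))

  x-a*0≈x : ∀ x a {z} → z ≈ 0# → x - a * z ≈ x
  x-a*0≈x x a {z} z≈0 = begin
    x - a * z  ≈⟨ +-congˡ (-‿cong (trans (*-congˡ z≈0) (zeroʳ a))) ⟩
    x - 0#     ≈⟨ +-congˡ -0#≈0# ⟩
    x + 0#     ≈⟨ +-identityʳ x ⟩
    x          ∎

module FiniteFieldMatroid {c ℓ} (R : CommutativeRing c ℓ)
                          {q} (isField : IsField R) (size : HasSize R q)
                          {n d} (A : Fin n → Fin d → CommutativeRing.Carrier R) where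
  open CommutativeRing R hiding (refl; zero)
  open RingProperties ring using (x∙y⁻¹≈ε⇒x≈y)
  open IsField isField
  open HasSize size
  open FiniteCarrier R size
  open VectorMatroid R A
  open VectorMatroidProperties R A

  cancel-coordinate : ∀ x {z} → ¬ (z ≈ 0#) → ∃ λ a → x - a * z ≈ 0#
  cancel-coordinate x {z} z≉0 = x * y , (begin
    x - x * y * z    ≈⟨ +-congˡ (-‿cong (*-assoc x y z)) ⟩
    x - x * (y * z)  ≈⟨ +-congˡ (-‿cong (*-congˡ (trans (*-comm y z) zy≈1))) ⟩
    x - x * 1#       ≈⟨ +-congˡ (-‿cong (*-identityʳ x)) ⟩
    x - x            ≈⟨ -‿inverseʳ x ⟩
    0#               ∎)
    where
    open SetoidReasoning setoid
    y = proj₁ (inverse z z≉0)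
    zy≈1 = proj₂ (inverse z z≉0)

  Dependent? : ∀ S → Dec (Dependent S)
  Dependent? S = anyVector? respects λ w →
    all? (λ i → ¬? (i ∈? S) →-dec (w i ≈? 0#)) ×-dec
    any? (λ i → ¬? (w i ≈? 0#)) ×-dec
    all? (λ j → sumF R n (λ i → w i * A i j) ≈? 0#)
    where
    respects : ∀ {u v} → (∀ i → u i ≈ v i) → SupportedIn S u × Nonzero u × InKernel u →
               SupportedIn S v × Nonzero v × InKernel v
    respects u≈v (u-supp , (i , ui≉0) , u-ker) =
      (λ i i∉S → trans (sym (u≈v i)) (u-supp i i∉S)) ,
      (i , ui≉0 ∘ trans (u≈v i)) ,
      InKernel-cong u≈v u-ker

  dependent⇒⊇circuit : ∀ {S} → Dependent S → ∃ λ C → C ⊆ S × Circuit C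
  dependent⇒⊇circuit {S} = go S (<-wellFounded ∣ S ∣)
    where
    go : ∀ S → Acc _<_ ∣ S ∣ → Dependent S → ∃ λ C → C ⊆ S × Circuit C
    go S (acc smaller) S-dep with any? (λ x → x ∈? S ×-dec Dependent? (S ─ ⁅ x ⁆))
    ... | yes (x , x∈S , S-x-dep) =
      let (C , C⊆S-x , C-circuit) = go (S ─ ⁅ x ⁆) (smaller (p⊂q⇒∣p∣<∣q∣ S-x⊂S)) S-x-dep
      in C , proj₁ S-x⊂S ∘ C⊆S-x , C-circuit
      where S-x⊂S = x∈p⇒p-x⊂p x∈S
    ... | no none = S , id , S-dep , λ { D (D⊆S , x , x∈S , x∉D) D-dep →
                      none (x , x∈S , Dependent-mono (p⊆q∧x∉p⇒p⊆q-x D⊆S x∉D) D-dep) }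

  independent⇒relation-vanishes : ∀ {B w} → Independent B → SupportedIn B w → InKernel w →
                                  ∀ i → w i ≈ 0#
  independent⇒relation-vanishes B-indep w-supp w-ker i =
    decidable-stable (_ ≈? 0#) λ wi≉0 → B-indep (_ , w-supp , (i , wi≉0) , w-ker)

  relation-involves-new-element : ∀ {B x w} → Independent B →
    SupportedIn (B ∪ ⁅ x ⁆) w → InKernel w → Nonzero w → ¬ (w x ≈ 0#)
  relation-involves-new-element B-indep w-supp w-ker w-nz wx≈0 =
    B-indep (_ , SupportedIn-∪⁅x⁆ w-supp wx≈0 , w-nz , w-ker)

  relations-proportional : ∀ {B e u v} → Independent B →
    SupportedIn (B ∪ ⁅ e ⁆) u → InKernel u → SupportedIn (B ∪ ⁅ e ⁆) v → InKernel v → ¬ (v e ≈ 0#) →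
    ∃ λ a → ∀ i → u i ≈ a * v i
  relations-proportional {B} {e} {u} {v} B-indep u-supp u-ker v-supp v-ker ve≉0 =
    a , λ i → x∙y⁻¹≈ε⇒x≈y _ _
              (independent⇒relation-vanishes B-indep w-supp (InKernel-u-a*v u-ker v-ker a) i)
    where
    a = proj₁ (cancel-coordinate (u e) ve≉0)
    w-supp : SupportedIn B (λ i → u i - a * v i)
    w-supp = SupportedIn-∪⁅x⁆ (λ i i∉ → trans (x-a*0≈x (u i) a (v-supp i i∉)) (u-supp i i∉))
                              (proj₂ (cancel-coordinate (u e) ve≉0))

  isNonzero : Carrier → Bool
  isNonzero x = not (does (x ≈? 0#))

  indicator-isNonzero-0 : ∀ {x} → x ≈ 0# → indicator (isNonzero x) ≡ 0
  indicator-isNonzero-0 {x} x≈0 = ≡.cong (indicator ∘ not) (dec-true (x ≈? 0#) x≈0)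

  supp : (Fin n → Carrier) → Subset n
  supp w = tabulate (isNonzero ∘ w)

  SupportedIn-supp : ∀ w → SupportedIn (supp w) w
  SupportedIn-supp w i i∉supp = decidable-stable (w i ≈? 0#) λ wi≉0 →
    i∉supp (lookup⇒[]= i (supp w)
      (≡.trans (lookup∘tabulate (isNonzero ∘ w) i) (≡.cong not (dec-false (w i ≈? 0#) wi≉0))))

  ∣supp∣≡∑ : ∀ w → ∣ supp w ∣ ≡ ∑[ i < n ] indicator (isNonzero (w i))
  ∣supp∣≡∑ w = ≡.trans (∣p∣≡∑indicator (supp w))
                       (sum-cong-≗ (≡.cong indicator ∘ lookup∘tabulate (isNonzero ∘ w)))

  paving⇒support-large : ∀ {r k w} → KPaving r k → InKernel w → Nonzero w →
                         r < ∣ supp w ∣ ℕ.+ k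
  paving⇒support-large {k = k} {w} paving w-ker w-nz =
    let (C , C⊆supp , C-circuit) = dependent⇒⊇circuit (w , SupportedIn-supp w , w-nz , w-ker)
        (t , t∈C) = Circuit-nonempty C-circuit
    in ℕₚ.≤-trans (paving t C C-circuit t∈C) (ℕₚ.+-monoˡ-≤ k (p⊆q⇒∣p∣≤∣q∣ C⊆supp))

  -- The q + 1 points of the projective line through u and v.
  pencil : (Fin n → Carrier) → (Fin n → Carrier) → Fin (suc q) → Fin n → Carrier
  pencil u v zero    i = v i
  pencil u v (suc l) i = u i - enum l * v i

  pencil-vanishes : ∀ u v i → ∃ λ j → pencil u v j i ≈ 0#
  pencil-vanishes u v i with v i ≈? 0#
  ... | yes vi≈0 = zero , vi≈0
  ... | no  vi≉0 =
    let (a , ui-avi≈0) = cancel-coordinate (u i) vi≉0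
    in suc (index a) , trans (+-congˡ (-‿cong (*-congʳ (enum-index a)))) ui-avi≈0

  pencil-zero : ∀ {u v i} → u i ≈ 0# → v i ≈ 0# → ∀ j → pencil u v j i ≈ 0#
  pencil-zero ui≈0 vi≈0 zero    = vi≈0
  pencil-zero ui≈0 vi≈0 (suc l) = trans (x-a*0≈x _ (enum l) vi≈0) ui≈0

  pencil-support-sum : ∀ {T u v} → SupportedIn T u → SupportedIn T v →
                       ∑[ j < suc q ] ∣ supp (pencil u v j) ∣ ≤ q ℕ.* ∣ T ∣
  pencil-support-sum {T} {u} {v} u-supp v-supp = begin
    ∑[ j < suc q ] ∣ supp (pencil u v j) ∣       ≡⟨ sum-cong-≗ (∣supp∣≡∑ ∘ pencil u v) ⟩
    ∑[ j < suc q ] ∑[ i < n ] nonzero j i        ≡⟨ ∑-comm nonzero ⟩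
    ∑[ i < n ] ∑[ j < suc q ] nonzero j i        ≤⟨ sum-mono-≤ coordinate-bound ⟩
    ∑[ i < n ] (q ℕ.* indicator (lookup T i))    ≡⟨ *-distribˡ-sum q (indicator ∘ lookup T) ⟨
    q ℕ.* ∑[ i < n ] indicator (lookup T i)      ≡⟨ ≡.cong (q ℕ.*_) (∣p∣≡∑indicator T) ⟨
    q ℕ.* ∣ T ∣                                  ∎
    where
    open ℕₚ.≤-Reasoning
    nonzero : Fin (suc q) → Fin n → ℕ
    nonzero j i = indicator (isNonzero (pencil u v j i))
    coordinate-bound : ∀ i → ∑[ j < suc q ] nonzero j i ≤ q ℕ.* indicator (lookup T i)
    coordinate-bound i with i ∈? T
    ... | yes i∈T rewrite []=⇒lookup i∈T | ℕₚ.*-identityʳ q =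
      let (j , vanishes) = pencil-vanishes u v i
      in sum-indicators-with-zero≤ (λ j → indicator≤1 (isNonzero (pencil u v j i))) j
                                   (indicator-isNonzero-0 vanishes)
    ... | no  i∉T = ℕₚ.≤-trans (ℕₚ.≤-reflexive (sum-zero {f = λ j → nonzero j i} λ j →
      indicator-isNonzero-0 (pencil-zero (u-supp i i∉T) (v-supp i i∉T) j))) z≤n

  module Basis {r} (rank : IsRank r) where
    B : Subset n
    B = proj₁ (proj₁ rank)

    B-independent : Independent B
    B-independent = proj₁ (proj₂ (proj₁ rank))

    ∣B∣≡r : ∣ B ∣ ≡ r
    ∣B∣≡r = proj₂ (proj₂ (proj₁ rank))

    B∪x-dependent : ∀ {x} → x ∉ B → Dependent (B ∪ ⁅ x ⁆)
    B∪x-dependent {x} x∉B = decidable-stable (Dependent? _) λ B∪x-independent →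
      ℕₚ.<⇒≱ (p⊂q⇒∣p∣<∣q∣ (p⊆p∪q ⁅ x ⁆ , x , x∈p∪q⁺ (inj₂ (x∈⁅x⁆ x)) , x∉B))
             (≡.subst (∣ B ∪ ⁅ x ⁆ ∣ ≤_) (≡.sym ∣B∣≡r) (proj₂ rank _ B∪x-independent))

    fundamental-relation : ∀ {x} → x ∉ B →
      ∃ λ w → SupportedIn (B ∪ ⁅ x ⁆) w × InKernel w × ¬ (w x ≈ 0#)
    fundamental-relation x∉B with B∪x-dependent x∉B
    ... | w , w-supp , w-nz , w-ker =
      w , w-supp , w-ker , relation-involves-new-element B-independent w-supp w-ker w-nz

    none-outside⇒RankBound : ∀ k → NoColoops → (∀ i → i ∈ B) → RankBound q k r
    none-outside⇒RankBound k noColoops all∈B =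
      ≡.subst (RankBound q k) r≡0 (RankBound-0 k size-positive)
      where
      B-empty : ¬ Nonempty B
      B-empty (x , _) = noColoops x λ C C-circuit _ →
        B-independent (Dependent-mono (λ {i} _ → all∈B i) (proj₁ C-circuit))
      r≡0 : 0 ≡ r
      r≡0 = ≡.trans (≡.sym (∣⊥∣≡0 n)) (≡.trans (≡.cong ∣_∣ (≡.sym (Empty-unique B-empty))) ∣B∣≡r)

    one-outside⇒circuit : NoColoops → ∀ {e} → e ∉ B → (∀ i → i ∉ B → i ≡ e) → IsCircuitMatroid
    one-outside⇒circuit noColoops {e} e∉B only-e =
      Dependent-mono (⊆-max _) (B∪x-dependent e∉B) , proper-independent
      where
      supported : ∀ w → SupportedIn (B ∪ ⁅ e ⁆) w
      supported w i i∉B∪e = contradiction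
        (x∈p∪q⁺ (inj₂ (≡.subst (_∈ ⁅ e ⁆) (≡.sym (only-e i (i∉B∪e ∘ p⊆p∪q ⁅ e ⁆))) (x∈⁅x⁆ e))))
        i∉B∪e
      proper-independent : ∀ D → D ⊂ ⊤ → Independent D
      proper-independent D (_ , x , _ , x∉D) (v , v-supp , v-nz , v-ker) =
        noColoops x x-in-no-circuit
        where
        ve≉0 : ¬ (v e ≈ 0#)
        ve≉0 = relation-involves-new-element B-independent (supported v) v-ker v-nz
        x-in-no-circuit : Coloop x
        x-in-no-circuit C C-circuit x∈C with proj₁ C-circuit
        ... | u , u-supp , u-nz , u-ker =
          let (a , u≈av) = relations-proportional B-independent
                             (supported u) u-ker (supported v) v-ker ve≉0
          in circuit-relation-nonzero C-circuit u-supp u-ker u-nz x∈C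
               (trans (u≈av x) (trans (*-congˡ (v-supp x x∉D)) (zeroʳ a)))

    two-outside⇒RankBound : ∀ {k} → KPaving r k →
                            ∀ {e f} → e ∉ B → f ∉ B → e ≢ f → RankBound q k r
    two-outside⇒RankBound {k} paving {e} {f} e∉B f∉B e≢f
      with fundamental-relation e∉B | fundamental-relation f∉B
    ... | c₁ , c₁-supp , c₁-ker , c₁e≉0 | c₂ , c₂-supp , c₂-ker , c₂f≉0 =
      pencil-count⇒RankBound q k r (λ j → ∣ supp (pencil c₁ c₂ j) ∣)
        (λ j → paving⇒support-large paving (pencil-kernel j) (pencil-nonzero j))
        (ℕₚ.≤-trans (pencil-support-sum (SupportedIn-mono (p⊆p∪q ⁅ f ⁆) c₁-supp)
                                        (SupportedIn-mono B∪f⊆T c₂-supp))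
                    (ℕₚ.*-monoʳ-≤ q ∣T∣≤2+r))
      where
      T : Subset n
      T = (B ∪ ⁅ e ⁆) ∪ ⁅ f ⁆
      B∪f⊆T : B ∪ ⁅ f ⁆ ⊆ T
      B∪f⊆T = x∈p∪q⁺ ∘ ⊎-map₁ (p⊆p∪q ⁅ e ⁆) ∘ x∈p∪q⁻ B ⁅ f ⁆
      ∣T∣≤2+r : ∣ T ∣ ≤ suc (suc r)
      ∣T∣≤2+r = ℕₚ.≤-trans (∣p∪⁅x⁆∣≤1+∣p∣ (B ∪ ⁅ e ⁆) f)
                  (s≤s (ℕₚ.≤-trans (∣p∪⁅x⁆∣≤1+∣p∣ B e) (s≤s (ℕₚ.≤-reflexive ∣B∣≡r))))
      c₂e≈0 : c₂ e ≈ 0#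
      c₂e≈0 = c₂-supp e ([ e∉B , e≢f ∘ x∈⁅y⁆⇒x≡y f ]′ ∘ x∈p∪q⁻ B ⁅ f ⁆)
      pencil-kernel : ∀ j → InKernel (pencil c₁ c₂ j)
      pencil-kernel zero    = c₂-ker
      pencil-kernel (suc l) = InKernel-u-a*v c₁-ker c₂-ker (enum l)
      pencil-nonzero : ∀ j → Nonzero (pencil c₁ c₂ j)
      pencil-nonzero zero    = f , c₂f≉0
      pencil-nonzero (suc l) = e , c₁e≉0 ∘ trans (sym (x-a*0≈x (c₁ e) (enum l) c₂e≈0))

open import Data.Nat using (_+_; _*_)

corollary1p3 : ∀ {c ℓ : Level} (q k : ℕ) → IsPrimePower q →
    (F : CommutativeRing c ℓ) → IsGF F q →
    (n d : ℕ) (A : Fin n → Fin d → CommutativeRing.Carrier F) →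
    (r : ℕ) → VectorMatroid.IsRank F A r →
    VectorMatroid.Simple F A →
    VectorMatroid.NoColoops F A →
    VectorMatroid.KPaving F A r k →
    VectorMatroid.IsCircuitMatroid F A ⊎ (r + (q + 1) ≤ (q + 1) * k + 2 * q)
corollary1p3 q k _ F (isField , size) n d A r rank _ noColoops paving =
  case misses-none-one-or-two B of λ
    { (inj₁ all∈B)                            → inj₂ (none-outside⇒RankBound k noColoops all∈B)
    ; (inj₂ (inj₁ (e , e∉B , only-e)))        → inj₁ (one-outside⇒circuit noColoops e∉B only-e)
    ; (inj₂ (inj₂ (e , f , e∉B , f∉B , e≢f))) → inj₂ (two-outside⇒RankBound paving e∉B f∉B e≢f)
    }
  where
  open FiniteFieldMatroid F isField size A
  open Basis rank
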